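{- Let the Motzkin numbers $M_n$ be defined by $M_0=M_1=1$ and $M_n=\frac{2n+1}{n+2}M_{n-1} +\frac{3n-3}{n+2}M_{n-2}$ for $n\geq 2$. The sequence $\{M_n\}_{n\geq 4}$ is ratio log-concave.
   Context: A sequence $(x_n)_{n\ge m}$ of positive reals is log-concave if $x_n^2\ge x_{n-1}x_{n+1}$ for all $n\ge m+1$. A sequence $(a_n)_{n\ge m}$ of positive reals is ratio log-concave if $(a_{n+1}/a_n)_{n\ge m}$ is log-concave. -}

module Defs where

open import Data.Nat as ℕ using (ℕ; zero; suc; pred; _+_)
open import Data.Integer using (+_)
open import Data.Rational using (ℚ; 0ℚ; 1ℚ; _/_; _÷_; _*_; _≤_; Positive; ≢-nonZero)
  renaming (_+_ to _+ℚ_)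
open import Data.Rational.Properties using (_≟_)
open import Data.Product using (_×_)
open import Relation.Nullary using (yes; no)

-- Motzkin numbers as rationals, via the paper's recurrence:
-- M 0 = M 1 = 1, M n = (2n+1)/(n+2) M(n-1) + (3n-3)/(n+2) M(n-2) for n ≥ 2.
-- For n = k+2: (2n+1) = 2k+5, (3n-3) = 3k+3, (n+2) = 4+k.
M : ℕ → ℚ
M zero = 1ℚ
M (suc zero) = 1ℚ
M (suc (suc k)) =
  ((+ (2 ℕ.* k + 5)) / (4 + k)) * M (suc k) +ℚ ((+ (3 ℕ.* k + 3)) / (4 + k)) * M k

-- Division made total (value at q = 0 is irrelevant: only used on positive sequences).
_div_ : ℚ → ℚ → ℚ
p div q with q ≟ 0ℚ
... | yes _ = 0ℚ
... | no q≢0 = _÷_ p q {{≢-nonZero q≢0}}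

LogConcave : ℕ → (ℕ → ℚ) → Set
LogConcave m x =
  (∀ n → m ℕ.≤ n → Positive (x n)) ×
  (∀ n → suc m ℕ.≤ n → x (pred n) * x (suc n) ≤ x n * x n)

RatioLogConcave : ℕ → (ℕ → ℚ) → Set
RatioLogConcave m a =
  (∀ n → m ℕ.≤ n → Positive (a n)) ×
  LogConcave m (λ n → a (suc n) div a n)

-- Write r n = M (n + 1) / M n.  The recurrence says r (n + 1) = f n (r n) with
-- f n x = ((2n + 5) x + 3n + 3) / ((n + 4) x), a decreasing function of x.  So bounds
-- L k ≤ r (7 + k) ≤ U k, with U linear and L quadratic in k, propagate by induction as
-- soon as the polynomial inequalities f (L k) ≤ U (k + 1) and L (k + 1) ≤ f (U k) hold.
-- For n = 8 + k, log-concavity r (n - 1) · f n (r n) ≤ r n ² then follows from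
-- r (n - 1) ≤ U k and U k ((2n + 5) x + 3n + 3) ≤ (n + 4) x³ for x = r n ≥ L (k + 1):
-- the cubic inequality holds at x = L (k + 1), where the difference of its sides also
-- has nonnegative derivative, so it persists for larger x.  The cases n = 5, 6, 7 are
-- numerical.  All inequalities are proved over ℕ on numerators and denominators and
-- transported to ℚ at the end.
module Submission where

open import Defs

-- A pair (a , b) stands for the fraction a / b, compared by cross-multiplication.
module Fraction where

  open import Data.Nat
  open import Data.Nat.Properties
  open import Data.Nat.Tactic.RingSolver using (solve)
  open import Data.List.Base using (_∷_; [])
  open import Data.Product using (_×_; _,_; proj₂)
  open import Relation.Binary.PropositionalEquality using (cong)

  infix  4 _≼_
  infixl 7 _·_

  _≼_ : ℕ × ℕ → ℕ × ℕ → Set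
  (a , b) ≼ (c , d) = a * d ≤ c * b

  _·_ : ℕ × ℕ → ℕ × ℕ → ℕ × ℕ
  (a , b) · (c , d) = a * c , b * d

  ≼-trans : ∀ x y z → .{{NonZero (proj₂ y)}} → x ≼ y → y ≼ z → x ≼ z
  ≼-trans (a , b) (c , d) (e , f) ad≤cb cf≤ed = *-cancelʳ-≤ (a * f) (e * b) d (begin
    a * f * d ≡⟨ solve (a ∷ f ∷ d ∷ []) ⟩
    a * d * f ≤⟨ *-monoˡ-≤ f ad≤cb ⟩
    c * b * f ≡⟨ solve (c ∷ b ∷ f ∷ []) ⟩
    c * f * b ≤⟨ *-monoˡ-≤ b cf≤ed ⟩
    e * d * b ≡⟨ solve (e ∷ d ∷ b ∷ []) ⟩
    e * b * d ∎)
    where open ≤-Reasoning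

  ·-monoˡ-≼ : ∀ x y z → x ≼ y → x · z ≼ y · z
  ·-monoˡ-≼ (a , b) (c , d) (e , f) ad≤cb = begin
    a * e * (d * f) ≡⟨ solve (a ∷ e ∷ d ∷ f ∷ []) ⟩
    a * d * (e * f) ≤⟨ *-monoˡ-≤ (e * f) ad≤cb ⟩
    c * b * (e * f) ≡⟨ solve (c ∷ b ∷ e ∷ f ∷ []) ⟩
    c * e * (b * f) ∎
    where open ≤-Reasoning

  next : ℕ → ℕ → ℕ → ℕ × ℕ → ℕ × ℕ
  next α β γ (a , b) = α * a + β * b , γ * a

  next-antitone : ∀ α β γ x y → x ≼ y → next α β γ y ≼ next α β γ x
  next-antitone α β γ (a , b) (c , d) ad≤cb = begin
    (α * c + β * d) * (γ * a)         ≡⟨ solve (α ∷ β ∷ γ ∷ a ∷ c ∷ d ∷ []) ⟩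
    α * γ * (a * c) + β * γ * (a * d) ≤⟨ +-monoʳ-≤ (α * γ * (a * c)) (*-monoʳ-≤ (β * γ) ad≤cb) ⟩
    α * γ * (a * c) + β * γ * (c * b) ≡⟨ solve (α ∷ β ∷ γ ∷ a ∷ b ∷ c ∷ []) ⟩
    (α * a + β * b) * (γ * c)         ∎
    where open ≤-Reasoning

  -- y · next x ≼ x · x says y (α x + β) ≤ γ x³.  For x = x₀ + t the difference is a
  -- cubic in t whose constant and linear coefficients are nonnegative by the last two
  -- hypotheses, and whose other coefficients are nonnegative anyway.
  ·next≼square-upward : ∀ α β γ y x₀ x → .{{NonZero (proj₂ x₀)}} → x₀ ≼ x →
    y · next α β γ x₀ ≼ x₀ · x₀ → (α , 1) · y ≼ (3 * γ , 1) · (x₀ · x₀) →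
    y · next α β γ x ≼ x · x
  ·next≼square-upward α β γ (u , v) (A , B) (a , b) Ab≤aB at-x₀ slope-at-x₀
    with s , Ab+s≡aB ← m≤n⇒∃[o]m+o≡n Ab≤aB
    = *-cancelʳ-≤ _ _ (B * B * B) {{m*n≢0 (B * B) B {{m*n≢0 B B}}}} (begin
    u * (α * a + β * b) * (b * b) * (B * B * B)
      ≡⟨ solve (α ∷ β ∷ u ∷ a ∷ b ∷ B ∷ []) ⟩
    b * b * (u * (B * B)) * (α * (a * B) + β * (b * B))
      ≡⟨ cong (λ t → b * b * (u * (B * B)) * (α * t + β * (b * B))) Ab+s≡aB ⟨
    b * b * (u * (B * B)) * (α * (A * b + s) + β * (b * B))
      ≡⟨ solve (α ∷ β ∷ u ∷ A ∷ B ∷ b ∷ s ∷ []) ⟩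
    b * b * b * (u * (α * A + β * B) * (B * B)) + b * b * s * (α * u * (1 * (B * B)))
      ≤⟨ +-mono-≤ (*-monoʳ-≤ (b * b * b) at-x₀) (*-monoʳ-≤ (b * b * s) slope-at-x₀) ⟩
    b * b * b * (A * A * (v * (γ * A))) + b * b * s * (3 * γ * (A * A) * (1 * v))
      ≤⟨ m≤m+n _ (3 * γ * v * A * b * s * s + γ * v * s * s * s) ⟩
    b * b * b * (A * A * (v * (γ * A))) + b * b * s * (3 * γ * (A * A) * (1 * v))
      + (3 * γ * v * A * b * s * s + γ * v * s * s * s)
      ≡⟨ solve (γ ∷ v ∷ A ∷ b ∷ s ∷ []) ⟩
    γ * v * ((A * b + s) * (A * b + s) * (A * b + s))
      ≡⟨ cong (λ t → γ * v * (t * t * t)) Ab+s≡aB ⟩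
    γ * v * (a * B * (a * B) * (a * B))
      ≡⟨ solve (γ ∷ v ∷ a ∷ B ∷ []) ⟩
    a * a * (v * (γ * a)) * (B * B * B) ∎)
    where open ≤-Reasoning

module MotzkinRatio where

  open import Data.Nat
  open import Data.Nat.Properties
  open import Data.Nat.Tactic.RingSolver using (solve-∀)
  open import Data.Product using (_×_; _,_; proj₁; proj₂)
  open import Data.Unit.Base using (tt)
  open import Relation.Binary.PropositionalEquality using (_≡_)

  open Fraction

  m≢0⇒m+n≢0 : ∀ m n → .{{NonZero m}} → NonZero (m + n)
  m≢0⇒m+n≢0 (suc m) n = _

  m+1+n-nonZero : ∀ m n → NonZero (m + suc n)
  m+1+n-nonZero m n = ≢-nonZero (m+1+n≢0 m)

  step : ℕ → ℕ × ℕ → ℕ × ℕ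
  step n = next (2 * n + 5) (3 * n + 3) (4 + n)

  ratio : ℕ → ℕ × ℕ
  ratio zero    = 1 , 1
  ratio (suc n) = step n (ratio n)

  ratio-nonZero : ∀ n → NonZero (proj₁ (ratio n)) × NonZero (proj₂ (ratio n))
  ratio-nonZero zero = _ , _
  ratio-nonZero (suc n) with a≢0 , _ ← ratio-nonZero n =
      m≢0⇒m+n≢0 _ _ {{m*n≢0 _ _ {{m+1+n-nonZero (2 * n) 4}} {{a≢0}}}}
    , m*n≢0 (4 + n) _ {{_}} {{a≢0}}

  upper lower : ℕ → ℕ × ℕ
  upper k = 24 * k + 201 , 8 * k + 79
  lower k = 48 * k * k + 1200 * k + 6651 , 16 * k * k + 424 * k + 2616

  -- In each certificate the slack is the difference of the two sides, a polynomial in k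
  -- with nonnegative coefficients.
  step-lower≼upper : ∀ k → step (7 + k) (lower k) ≼ upper (suc k)
  step-lower≼upper k = m+n≤o⇒m≤o _ (≤-reflexive (certificate k))
    where
    certificate : ∀ k → let α = 2 * (7 + k) + 5; β = 3 * (7 + k) + 3; γ = 4 + (7 + k)
                            L = 48 * k * k + 1200 * k + 6651; D = 16 * k * k + 424 * k + 2616
                            U = 24 * (1 + k) + 201; V = 8 * (1 + k) + 79
                        in (α * L + β * D) * V + (153 * k + 4914) ≡ U * (γ * L)
    certificate = solve-∀

  lower≼step-upper : ∀ k → lower (suc k) ≼ step (7 + k) (upper k)
  lower≼step-upper k = m+n≤o⇒m≤o _ (≤-reflexive (certificate k))
    where
    certificate : ∀ k → let α = 2 * (7 + k) + 5; β = 3 * (7 + k) + 3; γ = 4 + (7 + k)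
                            L = 48 * (1 + k) * (1 + k) + 1200 * (1 + k) + 6651
                            D = 16 * (1 + k) * (1 + k) + 424 * (1 + k) + 2616
                            U = 24 * k + 201; V = 8 * k + 79
                        in L * (γ * U) + (621 * k + 351) ≡ (α * U + β * V) * D
    certificate = solve-∀

  upper·step-lower≼square :
    ∀ k → upper k · step (8 + k) (lower (suc k)) ≼ lower (suc k) · lower (suc k)
  upper·step-lower≼square k = m+n≤o⇒m≤o _ (≤-reflexive (certificate k))
    where
    certificate : ∀ k →
      let α = 2 * (8 + k) + 5; β = 3 * (8 + k) + 3; γ = 4 + (8 + k)
          L = 48 * (1 + k) * (1 + k) + 1200 * (1 + k) + 6651
          D = 16 * (1 + k) * (1 + k) + 424 * (1 + k) + 2616
          U = 24 * k + 201; V = 8 * k + 79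
          slack = k * (k * (k * (k * (k * 988416 + 86693760) + 2862575856) + 44816607720)
                    + 333961974189) + 952277061276
      in U * (α * L + β * D) * (D * D) + slack ≡ L * L * (V * (γ * L))
    certificate = solve-∀

  cubic-slope-at-lower :
    ∀ k → (2 * (8 + k) + 5 , 1) · upper k ≼ (3 * (4 + (8 + k)) , 1) · (lower (suc k) · lower (suc k))
  cubic-slope-at-lower k = m+n≤o⇒m≤o _ (≤-reflexive (certificate k))
    where
    certificate : ∀ k →
      let α = 2 * (8 + k) + 5; γ = 4 + (8 + k)
          L = 48 * (1 + k) * (1 + k) + 1200 * (1 + k) + 6651
          D = 16 * (1 + k) * (1 + k) + 424 * (1 + k) + 2616
          U = 24 * k + 201; V = 8 * k + 79
          slack = k * (k * (k * (k * (k * (k * 43008 + 3263232) + 101405184) + 1652766240)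
                    + 14916020856) + 70760114949) + 138028614588
      in α * U * (1 * (D * D)) + slack ≡ 3 * γ * (L * L) * (1 * V)
    certificate = solve-∀

  -- Arguments are explicit and ratio-bounds k is projected rather than matched on:
  -- unification or with-abstraction would normalise the huge term ratio (8 + k).
  ratio-bounds : ∀ k → lower k ≼ ratio (7 + k) × ratio (7 + k) ≼ upper k
  ratio-bounds zero = ≤ᵇ⇒≤ _ _ tt , ≤ᵇ⇒≤ _ _ tt
  ratio-bounds (suc k) =
      ≼-trans (lower (suc k)) (step n (upper k)) (ratio (8 + k))
        {{m*n≢0 (4 + n) (24 * k + 201) {{_}} {{m+1+n-nonZero (24 * k) 200}}}}
        (lower≼step-upper k) (next-antitone α β γ (ratio n) (upper k) (proj₂ (ratio-bounds k)))
    , ≼-trans (ratio (8 + k)) (step n (lower k)) (upper (suc k))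
        {{m*n≢0 (4 + n) (48 * k * k + 1200 * k + 6651)
                {{_}} {{m+1+n-nonZero (48 * k * k + 1200 * k) 6650}}}}
        (next-antitone α β γ (lower k) (ratio n) (proj₁ (ratio-bounds k))) (step-lower≼upper k)
    where
    n = 7 + k
    α = 2 * n + 5
    β = 3 * n + 3
    γ = 4 + n

  ratio-logConcave : ∀ n → 5 ≤ n → ratio (pred n) · ratio (suc n) ≼ ratio n · ratio n
  ratio-logConcave 0 ()
  ratio-logConcave 1 (s≤s ())
  ratio-logConcave 2 (s≤s (s≤s ()))
  ratio-logConcave 3 (s≤s (s≤s (s≤s ())))
  ratio-logConcave 4 (s≤s (s≤s (s≤s (s≤s ()))))
  ratio-logConcave 5 _ = ≤ᵇ⇒≤ _ _ tt
  ratio-logConcave 6 _ = ≤ᵇ⇒≤ _ _ tt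
  ratio-logConcave 7 _ = ≤ᵇ⇒≤ _ _ tt
  ratio-logConcave (suc (suc (suc (suc (suc (suc (suc (suc k)))))))) _ =
    ≼-trans (ratio (7 + k) · ratio (9 + k)) (upper k · ratio (9 + k)) (ratio (8 + k) · ratio (8 + k))
      {{m*n≢0 (8 * k + 79) (proj₂ (ratio (9 + k)))
              {{m+1+n-nonZero (8 * k) 78}} {{proj₂ (ratio-nonZero (9 + k))}}}}
      (·-monoˡ-≼ (ratio (7 + k)) (upper k) (ratio (9 + k)) (proj₂ (ratio-bounds k)))
      (·next≼square-upward (2 * n + 5) (3 * n + 3) (4 + n) (upper k) (lower (suc k)) (ratio n)
        {{m+1+n-nonZero (16 * (1 + k) * (1 + k) + 424 * (1 + k)) 2615}}
        (proj₁ (ratio-bounds (suc k))) (upper·step-lower≼square k) (cubic-slope-at-lower k))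
    where n = 8 + k

open import Data.Nat as ℕ using (ℕ; zero; suc; pred; NonZero)
import Data.Nat.Properties as ℕ
open import Data.Nat.Coprimality using (1-coprimeTo) renaming (sym to coprime-sym)
open import Data.Integer as ℤ using (+_)
import Data.Integer.Properties as ℤ
open import Data.Rational using (ℚ; mkℚ; *≤*; _/_; _*_; _+_; _≤_; 1/_; 0ℚ; 1ℚ; Positive; toℚᵘ)
open import Data.Rational.Properties
open import Data.Rational.Solver using (module +-*-Solver)
import Data.Rational.Unnormalised as ℚᵘ
import Data.Rational.Unnormalised.Properties as ℚᵘ
open import Data.Product using (_×_; _,_; proj₁; proj₂)
open import Data.Empty using (⊥-elim)
open import Relation.Binary.PropositionalEquality
open import Relation.Nullary using (yes; no)
open import Algebra.Bundles using (CommutativeRing)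
open import Algebra.Properties.CommutativeSemigroup (CommutativeRing.*-commutativeSemigroup +-*-commutativeRing)
  using (interchange; xy∙z≈xz∙y; xy∙z≈x∙zy; xy∙z≈y∙xz)

open Fraction using (_≼_; _·_)
open MotzkinRatio using (ratio; ratio-nonZero; ratio-logConcave; m+1+n-nonZero)

ι : ℕ → ℚ
ι n = mkℚ (+ n) 0 (coprime-sym (1-coprimeTo n))

ι-+ : ∀ m n → ι (m ℕ.+ n) ≡ ι m + ι n
ι-+ m n = toℚᵘ-injective (ℚᵘ.≃-sym (ℚᵘ.≃-trans (toℚᵘ-homo-+ (ι m) (ι n))
  (ℚᵘ.*≡* (cong (ℤ._* + 1) (cong₂ ℤ._+_ (ℤ.*-identityʳ (+ m)) (ℤ.*-identityʳ (+ n)))))))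

ι-* : ∀ m n → ι (m ℕ.* n) ≡ ι m * ι n
ι-* m n = toℚᵘ-injective (ℚᵘ.≃-sym (ℚᵘ.≃-trans (toℚᵘ-homo-* (ι m) (ι n))
  (ℚᵘ.*≡* (cong (ℤ._* + 1) (sym (ℤ.pos-* m n))))))

ι-mono-≤ : ∀ {m n} → m ℕ.≤ n → ι m ≤ ι n
ι-mono-≤ {m} {n} m≤n =
  *≤* (subst₂ ℤ._≤_ (sym (ℤ.*-identityʳ (+ m))) (sym (ℤ.*-identityʳ (+ n))) (ℤ.+≤+ m≤n))

ι-positive : ∀ n → .{{NonZero n}} → Positive (ι n)
ι-positive (suc n) = _

/-*-ι : ∀ a d → (+ a / suc d) * ι (suc d) ≡ ι a
/-*-ι a d = toℚᵘ-injective (ℚᵘ.≃-trans (toℚᵘ-homo-* (+ a / suc d) (ι (suc d)))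
  (ℚᵘ.≃-trans (ℚᵘ.*-congʳ (toℚᵘ-fromℚᵘ (ℚᵘ.mkℚᵘ (+ a) d)))
  (ℚᵘ.*≡* (trans (ℤ.*-identityʳ _) (cong (λ t → + a ℤ.* + t) (sym (ℕ.*-identityʳ (suc d))))))))

infix 4 _≐_

_≐_ : ℚ → ℕ × ℕ → Set
x ≐ (a , b) = x * ι b ≡ ι a

≐-· : ∀ x y p q → x ≐ p → y ≐ q → x * y ≐ p · q
≐-· x y (a , b) (c , d) xb≡a yd≡c = begin
  x * y * ι (b ℕ.* d) ≡⟨ cong (x * y *_) (ι-* b d) ⟩
  x * y * (ι b * ι d) ≡⟨ interchange x y (ι b) (ι d) ⟩
  x * ι b * (y * ι d) ≡⟨ cong₂ _*_ xb≡a yd≡c ⟩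
  ι a * ι c           ≡⟨ ι-* a c ⟨
  ι (a ℕ.* c)         ∎
  where open ≡-Reasoning

≐-mono-≤ : ∀ x y p q → .{{NonZero (proj₂ p)}} → .{{NonZero (proj₂ q)}} →
           x ≐ p → y ≐ q → p ≼ q → x ≤ y
≐-mono-≤ x y (a , b) (c , d) xb≡a yd≡c ad≤cb =
  *-cancelʳ-≤-pos (ι b * ι d) {{pos*pos⇒pos (ι b) {{ι-positive b}} (ι d) {{ι-positive d}}}} (begin
    x * (ι b * ι d) ≡⟨ *-assoc x (ι b) (ι d) ⟨
    x * ι b * ι d   ≡⟨ cong (_* ι d) xb≡a ⟩
    ι a * ι d       ≡⟨ ι-* a d ⟨
    ι (a ℕ.* d)     ≤⟨ ι-mono-≤ ad≤cb ⟩
    ι (c ℕ.* b)     ≡⟨ ι-* c b ⟩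
    ι c * ι b       ≡⟨ cong (_* ι b) yd≡c ⟨
    y * ι d * ι b   ≡⟨ xy∙z≈x∙zy y (ι d) (ι b) ⟩
    y * (ι b * ι d) ∎)
  where open ≤-Reasoning

≐-logConcave : ∀ (r : ℕ → ℚ) (ρ : ℕ → ℕ × ℕ) →
               (∀ n → r n ≐ ρ n) → (∀ n → NonZero (proj₂ (ρ n))) →
               ∀ n → ρ (pred n) · ρ (suc n) ≼ ρ n · ρ n → r (pred n) * r (suc n) ≤ r n * r n
≐-logConcave r ρ r≐ρ ρ≢0 n =
  ≐-mono-≤ (r (pred n) * r (suc n)) (r n * r n) (ρ (pred n) · ρ (suc n)) (ρ n · ρ n)
  {{ℕ.m*n≢0 _ _ {{ρ≢0 (pred n)}} {{ρ≢0 (suc n)}}}} {{ℕ.m*n≢0 _ _ {{ρ≢0 n}} {{ρ≢0 n}}}}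
  (≐-· (r (pred n)) (r (suc n)) (ρ (pred n)) (ρ (suc n)) (r≐ρ (pred n)) (r≐ρ (suc n)))
  (≐-· (r n) (r n) (ρ n) (ρ n) (r≐ρ n) (r≐ρ n))

div-≡-*1/ : ∀ x y .{{_ : Positive y}} → x div y ≡ x * (1/ y) {{pos⇒nonZero y}}
div-≡-*1/ x y with y ≟ 0ℚ
... | yes refl = ⊥-elim (<-irrefl refl (positive⁻¹ 0ℚ))
... | no _     = refl

div-positive : ∀ x y .{{_ : Positive x}} .{{_ : Positive y}} → Positive (x div y)
div-positive x y = subst Positive (sym (div-≡-*1/ x y))
  (pos*pos⇒pos x ((1/ y) {{pos⇒nonZero y}}) {{1/pos⇒pos y}})

div-≐ : ∀ x y p .{{_ : Positive y}} → x * ι (proj₂ p) ≡ y * ι (proj₁ p) → x div y ≐ p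
div-≐ x y (a , b) xb≡ya = begin
  x div y * ι b    ≡⟨ cong (_* ι b) (div-≡-*1/ x y) ⟩
  x * y⁻¹ * ι b    ≡⟨ xy∙z≈xz∙y x y⁻¹ (ι b) ⟩
  x * ι b * y⁻¹    ≡⟨ cong (_* y⁻¹) xb≡ya ⟩
  y * ι a * y⁻¹    ≡⟨ xy∙z≈y∙xz y (ι a) y⁻¹ ⟩
  ι a * (y * y⁻¹)  ≡⟨ cong (ι a *_) (*-inverseʳ y {{pos⇒nonZero y}}) ⟩
  ι a * 1ℚ         ≡⟨ *-identityʳ (ι a) ⟩
  ι a              ∎
  where
  open ≡-Reasoning
  y⁻¹ = (1/ y) {{pos⇒nonZero y}}

M-positive : ∀ n → Positive (M n)
M-positive zero          = _
M-positive (suc zero)    = _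
M-positive (suc (suc k)) =
  pos+pos⇒pos (c₁ * M (suc k)) {{pos*pos⇒pos c₁ {{c₁-positive}} (M (suc k)) {{M-positive (suc k)}}}}
              (c₂ * M k)       {{pos*pos⇒pos c₂ {{c₂-positive}} (M k) {{M-positive k}}}}
  where
  c₁ = + (2 ℕ.* k ℕ.+ 5) / (4 ℕ.+ k)
  c₂ = + (3 ℕ.* k ℕ.+ 3) / (4 ℕ.+ k)
  c₁-positive : Positive c₁
  c₁-positive = normalize-pos _ _ {{_}} {{m+1+n-nonZero (2 ℕ.* k) 4}}
  c₂-positive : Positive c₂
  c₂-positive = normalize-pos _ _ {{_}} {{m+1+n-nonZero (3 ℕ.* k) 2}}

M-cross-ratio : ∀ n → M (suc n) * ι (proj₂ (ratio n)) ≡ M n * ι (proj₁ (ratio n))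
M-cross-ratio zero    = refl
M-cross-ratio (suc k) = begin
  M (suc (suc k)) * ι ((4 ℕ.+ k) ℕ.* a)
    ≡⟨ cong (M (suc (suc k)) *_) (ι-* (4 ℕ.+ k) a) ⟩
  (c₁ * M (suc k) + c₂ * M k) * (ι (4 ℕ.+ k) * ι a)
    ≡⟨ solve 6 (λ c₁ c₂ M₁ M₀ D x → (c₁ :* M₁ :+ c₂ :* M₀) :* (D :* x)
                                  := (c₁ :* D) :* (M₁ :* x) :+ (c₂ :* D) :* (M₀ :* x))
               refl c₁ c₂ (M (suc k)) (M k) (ι (4 ℕ.+ k)) (ι a) ⟩
  c₁ * ι (4 ℕ.+ k) * (M (suc k) * ι a) + c₂ * ι (4 ℕ.+ k) * (M k * ι a)
    ≡⟨ cong₂ (λ u v → u * (M (suc k) * ι a) + v * (M k * ι a))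
             (/-*-ι α (3 ℕ.+ k)) (/-*-ι β (3 ℕ.+ k)) ⟩
  ι α * (M (suc k) * ι a) + ι β * (M k * ι a)
    ≡⟨ cong (λ t → ι α * (M (suc k) * ι a) + ι β * t) (M-cross-ratio k) ⟨
  ι α * (M (suc k) * ι a) + ι β * (M (suc k) * ι b)
    ≡⟨ solve 5 (λ A B M₁ x y → A :* (M₁ :* x) :+ B :* (M₁ :* y) := M₁ :* (A :* x :+ B :* y))
               refl (ι α) (ι β) (M (suc k)) (ι a) (ι b) ⟩
  M (suc k) * (ι α * ι a + ι β * ι b)
    ≡⟨ cong (M (suc k) *_) (trans (ι-+ (α ℕ.* a) (β ℕ.* b)) (cong₂ _+_ (ι-* α a) (ι-* β b))) ⟨
  M (suc k) * ι (α ℕ.* a ℕ.+ β ℕ.* b) ∎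
  where
  open ≡-Reasoning
  open +-*-Solver
  a = proj₁ (ratio k)
  b = proj₂ (ratio k)
  α = 2 ℕ.* k ℕ.+ 5
  β = 3 ℕ.* k ℕ.+ 3
  c₁ = + α / (4 ℕ.+ k)
  c₂ = + β / (4 ℕ.+ k)

quotient-≐-ratio : ∀ n → M (suc n) div M n ≐ ratio n
quotient-≐-ratio n = div-≐ (M (suc n)) (M n) (ratio n) {{M-positive n}} (M-cross-ratio n)

theorem4p3 : RatioLogConcave 4 M
theorem4p3 =
    (λ n _ → M-positive n)
  , (λ n _ → div-positive (M (suc n)) (M n) {{M-positive (suc n)}} {{M-positive n}})
  , λ n 5≤n → ≐-logConcave (λ n → M (suc n) div M n) ratio quotient-≐-ratio
                (λ n → proj₂ (ratio-nonZero n)) n (ratio-logConcave n 5≤n)
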